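{- For all integers $b\ge2$ and $n\ge2$, \[ \sum_{\substack{1\le i\le b-1\\ 1\le j\le n-2}}\frac{1}{i(b-i)}\binom{j}{i-1}\binom{j-1}{i-1}\binom{n-1-j}{b-i-1}\binom{n-2-j}{b-i-1}=\frac{2}{b}\binom{n-1}{b-2}\binom{n-2}{b-1}. \]
   Context: Binomial coefficients $\binom{p}{q}$ with $p\ge 0$ are taken to be $0$ when $q<0$ or $q>p$. -}

module Defs where

open import Data.Nat using (ℕ; zero; suc; _+_; _*_; _∸_)
open import Data.Nat.Combinatorics using (_C_)
open import Data.Integer using (+_)
open import Data.Rational using (ℚ; _/_; 0ℚ) renaming (_+_ to _+ℚ_)

-- Σ[ i ∈ [lo, hi] ] f i  (inclusive range, empty if hi < lo), in ℚ.
-- sumFrom lo k f = f lo + f (lo+1) + ... + f (lo+k-1)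
sumFrom : ℕ → ℕ → (ℕ → ℚ) → ℚ
sumFrom lo zero    f = 0ℚ
sumFrom lo (suc k) f = f lo +ℚ sumFrom (suc lo) k f

sumRange : ℕ → ℕ → (ℕ → ℚ) → ℚ
sumRange lo hi f = sumFrom lo (suc hi ∸ lo) f

-- p / q as a rational; only used with q ≥ 1 (value 0 for q = 0 is a dummy).
frac : ℕ → ℕ → ℚ
frac p zero    = 0ℚ
frac p (suc q) = (+ p) / suc q

-- The summand  1/(i(b-i)) * C(j,i-1) C(j-1,i-1) C(n-1-j,b-i-1) C(n-2-j,b-i-1),
-- only evaluated for 1 ≤ i ≤ b-1 and 1 ≤ j ≤ n-2, where all ∸ are genuine subtractions.
summand : ℕ → ℕ → ℕ → ℕ → ℚ
summand b n i j =
  frac ((j C (i ∸ 1)) * ((j ∸ 1) C (i ∸ 1))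
        * ((n ∸ 1 ∸ j) C (b ∸ i ∸ 1)) * ((n ∸ 2 ∸ j) C (b ∸ i ∸ 1)))
       (i * (b ∸ i))

LHS : ℕ → ℕ → ℚ
LHS b n = sumRange 1 (b ∸ 1) λ i → sumRange 1 (n ∸ 2) λ j → summand b n i j

RHS : ℕ → ℕ → ℚ
RHS b n = frac (2 * (((n ∸ 1) C (b ∸ 2)) * ((n ∸ 2) C (b ∸ 1)))) b

module Submission where

-- The summand of the corollary is a product of two Narayana numbers:
-- writing  i = k+1,  j = m+1,  b = c+2,  n = M+2,
--   1/(i(b-i)) C(j,i-1) C(j-1,i-1) C(n-1-j,b-i-1) C(n-2-j,b-i-1)
--     = N₁(m+1, k) · N₁(M-m, c-k),   N₁(p+1, k) = C(p+1,k) C(p,k) / (k+1),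
-- so the left-hand side is the two-fold convolution of the Narayana
-- triangle, and the right-hand side is the closed form of that convolution.
--
-- The proof works with the generalised Narayana numbers
--   N_r(0, c) = [r = 0 ∧ c = 0],   N_r(n+1, c) = C(n+1,c+r) C(n,c) − C(n,c+r) C(n+1,c),
-- a 2×2 minor of Pascal's triangle.  Expanding such a minor by Pascal's rule
-- gives a recurrence for N_(r+1)(n+1) in terms of N_r, N_(r+1), N_(r+2) at n,
-- and induction on n with this recurrence proves the convolution law
--   Σ_{j ≤ n} Σ_{k ≤ c} N_r(j,k) N_s(n-j,c-k) = N_(r+s)(n,c).
-- Absorption identities for binomial coefficients identify N₁ and N₂ with
-- the products of binomials appearing in the statement.

open import Defs
open import Data.Nat using (ℕ; _≥_)
open import Relation.Binary.PropositionalEquality using (_≡_)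

open import Data.Nat as ℕ using (zero; suc; _<_; _∸_; s≤s)
import Data.Nat.Properties as ℕP
open import Data.Nat.Combinatorics using (_C_; nC1≡n; nCk+nC[k+1]≡[n+1]C[k+1])
open import Data.Fin using (Fin; toℕ)
open import Data.Fin.Properties using (toℕ-inject₁; toℕ-fromℕ)
open import Data.Integer using (ℤ; +_; -[1+_]; 0ℤ; 1ℤ; _+_; _-_; _*_; -_)
import Data.Integer.Properties as ℤP
open import Data.Integer.Tactic.RingSolver using (solve-∀)
open import Algebra.Properties.Semiring.Sum ℤP.+-*-semiring
  using (sum; sum-cong-≗; ∑-distrib-+; ∑-comm; sum-init-last; sum-replicate-zero)
open import Data.Rational as ℚ using (ℚ; _/_)
import Data.Rational.Properties as ℚP
import Data.Rational.Unnormalised as ℚᵘ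
import Data.Rational.Unnormalised.Properties as ℚᵘP
open import Relation.Binary.PropositionalEquality
  using (refl; sym; trans; cong; cong₂; module ≡-Reasoning)

open ≡-Reasoning

-- Integer identities derived by linear combination: if  L − R  is an integer
-- combination of the differences  lᵢ − rᵢ,  then the equations  lᵢ ≡ rᵢ
-- imply  L ≡ R.

difference-vanishes : ∀ {l r : ℤ} (c : ℤ) → l ≡ r → c * (l - r) ≡ 0ℤ
difference-vanishes {r = r} c refl = trans (cong (c *_) (ℤP.+-inverseʳ r)) (ℤP.*-zeroʳ c)

combine₂ : ∀ {L R l₁ r₁ l₂ r₂ : ℤ} (c₁ c₂ : ℤ) →
           L - R ≡ c₁ * (l₁ - r₁) + c₂ * (l₂ - r₂) →
           l₁ ≡ r₁ → l₂ ≡ r₂ → L ≡ R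
combine₂ {L} {R} c₁ c₂ comb e₁ e₂ = ℤP.i-j≡0⇒i≡j L R
  (trans comb (cong₂ _+_ (difference-vanishes c₁ e₁) (difference-vanishes c₂ e₂)))

combine₃ : ∀ {L R l₁ r₁ l₂ r₂ l₃ r₃ : ℤ} (c₁ c₂ c₃ : ℤ) →
           L - R ≡ c₁ * (l₁ - r₁) + c₂ * (l₂ - r₂) + c₃ * (l₃ - r₃) →
           l₁ ≡ r₁ → l₂ ≡ r₂ → l₃ ≡ r₃ → L ≡ R
combine₃ {L} {R} c₁ c₂ c₃ comb e₁ e₂ e₃ = ℤP.i-j≡0⇒i≡j L R
  (trans comb (cong₂ _+_ (cong₂ _+_ (difference-vanishes c₁ e₁) (difference-vanishes c₂ e₂))
                         (difference-vanishes c₃ e₃)))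

binom : ℕ → ℕ → ℤ
binom n       zero    = 1ℤ
binom zero    (suc k) = 0ℤ
binom (suc n) (suc k) = binom n k + binom n (suc k)

binom≡C : ∀ n k → binom n k ≡ + (n C k)
binom≡C n       zero    = refl
binom≡C zero    (suc k) = refl
binom≡C (suc n) (suc k) =
  trans (cong₂ _+_ (binom≡C n k) (binom≡C n (suc k))) (cong +_ (nCk+nC[k+1]≡[n+1]C[k+1] n k))

binom-product : ∀ n k n′ k′ → binom n k * binom n′ k′ ≡ + ((n C k) ℕ.* (n′ C k′))
binom-product n k n′ k′ =
  trans (cong₂ _*_ (binom≡C n k) (binom≡C n′ k′)) (sym (ℤP.pos-* (n C k) (n′ C k′)))

absorb₁ : ∀ n k → + suc k * binom (suc n) (suc k) ≡ + suc n * binom n k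
absorb₁ n       zero    =
  trans (ℤP.*-identityˡ _)
    (trans (cong (λ x → 1ℤ + x) (trans (binom≡C n 1) (cong +_ (nC1≡n n))))
           (sym (ℤP.*-identityʳ _)))
absorb₁ zero    (suc k) = ℤP.*-zeroʳ (+ suc (suc k))
absorb₁ (suc n) (suc k) =
  combine₂ 1ℤ 1ℤ (step (+ k) (+ n) (binom n k) (binom n (suc k)) (binom (suc n) (suc (suc k))))
    (absorb₁ n k) (absorb₁ n (suc k))
  where
  step : ∀ K N p q b →
    (1ℤ + (1ℤ + K)) * ((p + q) + b) - (1ℤ + (1ℤ + N)) * (p + q)
    ≡ 1ℤ * ((1ℤ + K) * (p + q) - (1ℤ + N) * p) + 1ℤ * ((1ℤ + (1ℤ + K)) * b - (1ℤ + N) * q)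
  step = solve-∀

absorb₂ : ∀ n k → + suc k * binom n (suc k) + + k * binom n k ≡ + n * binom n k
absorb₂ zero    zero    = refl
absorb₂ zero    (suc k) = cong₂ _+_ (ℤP.*-zeroʳ (+ suc (suc k))) (ℤP.*-zeroʳ (+ suc k))
absorb₂ (suc n) zero    = trans (ℤP.+-identityʳ _) (absorb₁ n zero)
absorb₂ (suc n) (suc k) =
  combine₂ 1ℤ 1ℤ (step (+ k) (+ n) (binom n k) (binom n (suc k)) (binom (suc n) (suc (suc k))))
    (absorb₁ n (suc k)) (absorb₁ n k)
  where
  step : ∀ K N p q b →
    ((1ℤ + (1ℤ + K)) * b + (1ℤ + K) * (p + q)) - (1ℤ + N) * (p + q)
    ≡ 1ℤ * ((1ℤ + (1ℤ + K)) * b - (1ℤ + N) * q) + 1ℤ * ((1ℤ + K) * (p + q) - (1ℤ + N) * p)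
  step = solve-∀

absorb₃ : ∀ n k → + suc n * binom n k + + k * binom (suc n) k ≡ + suc n * binom (suc n) k
absorb₃ n k =
  combine₂ (- 1ℤ) 1ℤ (step (+ k) (+ n) (binom n k) (binom (suc n) k) (binom (suc n) (suc k)))
    (absorb₁ n k) (absorb₂ (suc n) k)
  where
  step : ∀ K N p u a →
    ((1ℤ + N) * p + K * u) - (1ℤ + N) * u
    ≡ (- 1ℤ) * ((1ℤ + K) * a - (1ℤ + N) * p) + 1ℤ * (((1ℤ + K) * a + K * u) - (1ℤ + N) * u)
  step = solve-∀

-- Binomial coefficients with an integer lower index, zero below the triangle;
-- Pascal's rule then holds without side conditions.

binomℤ : ℕ → ℤ → ℤ
binomℤ n (+ k)    = binom n k
binomℤ n -[1+ k ] = 0ℤ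

pascal : ∀ n k → binomℤ (suc n) k ≡ binomℤ n k + binomℤ n (k - 1ℤ)
pascal n (+ zero)  = refl
pascal n (+ suc k) = ℤP.+-comm (binom n k) (binom n (suc k))
pascal n -[1+ k ]  = refl

minor : ℕ → ℤ → ℤ → ℤ
minor n a c = binomℤ (suc n) a * binomℤ n c - binomℤ n a * binomℤ (suc n) c

minor-expand : ∀ n a c →
  minor n a c ≡ (binomℤ n a + binomℤ n (a - 1ℤ)) * binomℤ n c
                - binomℤ n a * (binomℤ n c + binomℤ n (c - 1ℤ))
minor-expand n a c = cong₂ (λ x y → x * binomℤ n c - binomℤ n a * y) (pascal n a) (pascal n c)

-- Expanding every entry of a minor by Pascal's rule splits it into four
-- minors one row higher.
minor-rec : ∀ n a c →
  minor (suc n) a c ≡ minor n (a - 1ℤ) c + minor n a c + minor n (a - 1ℤ) (c - 1ℤ) + minor n a (c - 1ℤ)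
minor-rec n a c = begin
    minor (suc n) a c
  ≡⟨ cong₂ _-_ (cong₂ _*_ (pascal² a) (pascal n c)) (cong₂ _*_ (pascal n a) (pascal² c)) ⟩
    ((X₀ + X₁) + (X₁ + X₂)) * (Y₀ + Y₁) - (X₀ + X₁) * ((Y₀ + Y₁) + (Y₁ + Y₂))
  ≡⟨ split X₀ X₁ X₂ Y₀ Y₁ Y₂ ⟩
    ((X₁ + X₂) * Y₀ - X₁ * (Y₀ + Y₁)) + ((X₀ + X₁) * Y₀ - X₀ * (Y₀ + Y₁))
      + ((X₁ + X₂) * Y₁ - X₁ * (Y₁ + Y₂)) + ((X₀ + X₁) * Y₁ - X₀ * (Y₁ + Y₂))
  ≡⟨ sym (cong₂ _+_ (cong₂ _+_ (cong₂ _+_ (minor-expand n (a - 1ℤ) c) (minor-expand n a c))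
                                (minor-expand n (a - 1ℤ) (c - 1ℤ)))
                     (minor-expand n a (c - 1ℤ))) ⟩
    minor n (a - 1ℤ) c + minor n a c + minor n (a - 1ℤ) (c - 1ℤ) + minor n a (c - 1ℤ)
  ∎
  where
  X₀ X₁ X₂ Y₀ Y₁ Y₂ : ℤ
  X₀ = binomℤ n a
  X₁ = binomℤ n (a - 1ℤ)
  X₂ = binomℤ n (a - 1ℤ - 1ℤ)
  Y₀ = binomℤ n c
  Y₁ = binomℤ n (c - 1ℤ)
  Y₂ = binomℤ n (c - 1ℤ - 1ℤ)
  pascal² : ∀ x → binomℤ (suc (suc n)) x
                  ≡ (binomℤ n x + binomℤ n (x - 1ℤ)) + (binomℤ n (x - 1ℤ) + binomℤ n (x - 1ℤ - 1ℤ))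
  pascal² x = trans (pascal (suc n) x) (cong₂ _+_ (pascal n x) (pascal n (x - 1ℤ)))
  split : ∀ X₀ X₁ X₂ Y₀ Y₁ Y₂ →
    ((X₀ + X₁) + (X₁ + X₂)) * (Y₀ + Y₁) - (X₀ + X₁) * ((Y₀ + Y₁) + (Y₁ + Y₂))
    ≡ ((X₁ + X₂) * Y₀ - X₁ * (Y₀ + Y₁)) + ((X₀ + X₁) * Y₀ - X₀ * (Y₀ + Y₁))
      + ((X₁ + X₂) * Y₁ - X₁ * (Y₁ + Y₂)) + ((X₀ + X₁) * Y₁ - X₀ * (Y₁ + Y₂))
  split = solve-∀

minor-diagonal : ∀ n a → minor n a a ≡ 0ℤ
minor-diagonal n a =
  trans (cong (λ x → binomℤ (suc n) a * binomℤ n a - x) (ℤP.*-comm (binomℤ n a) (binomℤ (suc n) a)))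
        (ℤP.+-inverseʳ (binomℤ (suc n) a * binomℤ n a))

minor-below : ∀ n a k → minor n a -[1+ k ] ≡ 0ℤ
minor-below n a k = cong₂ _-_ (ℤP.*-zeroʳ (binomℤ (suc n) a)) (ℤP.*-zeroʳ (binomℤ n a))

-- Generalised Narayana numbers  N_r(n, c);  N₁ is the Narayana triangle and
-- N_r is its r-fold convolution (theorem  convolution  below).
narayana : ℕ → ℕ → ℕ → ℤ
narayana r       (suc n) c       = minor n (+ (c ℕ.+ r)) (+ c)
narayana zero    zero    zero    = 1ℤ
narayana zero    zero    (suc c) = 0ℤ
narayana (suc r) zero    c       = 0ℤ

narayana-rank-zero : ∀ n c → narayana 0 (suc n) c ≡ 0ℤ
narayana-rank-zero n c =
  trans (cong (λ x → minor n (+ x) (+ c)) (ℕP.+-identityʳ c)) (minor-diagonal n (+ c))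

shift : (ℕ → ℤ) → ℕ → ℤ
shift f zero    = 0ℤ
shift f (suc c) = f c

shift-cong : ∀ {f g : ℕ → ℤ} → (∀ c → f c ≡ g c) → ∀ c → shift f c ≡ shift g c
shift-cong e zero    = refl
shift-cong e (suc c) = e c

narayana-rec : ∀ r n c →
  narayana (suc r) (suc n) c
  ≡ (narayana r n c + narayana (suc r) n c)
    + shift (λ c′ → narayana (suc r) n c′ + narayana (suc (suc r)) n c′) c
narayana-rec zero    zero zero    = refl
narayana-rec (suc r) zero zero    = refl
narayana-rec zero    zero (suc c) = cong (_- 0ℤ) (ℤP.*-zeroʳ (binom 1 (suc (c ℕ.+ 1))))
narayana-rec (suc r) zero (suc c) = cong (_- 0ℤ) (ℤP.*-zeroʳ (binom 1 (suc (c ℕ.+ suc (suc r)))))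
narayana-rec r (suc m) c = begin
    minor (suc m) (column c) (+ c)
  ≡⟨ minor-rec m (column c) (+ c) ⟩
    minor m (column c - 1ℤ) (+ c) + minor m (column c) (+ c)
      + minor m (column c - 1ℤ) (+ c - 1ℤ) + minor m (column c) (+ c - 1ℤ)
  ≡⟨ ℤP.+-assoc (minor m (column c - 1ℤ) (+ c) + minor m (column c) (+ c))
                (minor m (column c - 1ℤ) (+ c - 1ℤ)) (minor m (column c) (+ c - 1ℤ)) ⟩
    (minor m (column c - 1ℤ) (+ c) + minor m (column c) (+ c))
      + (minor m (column c - 1ℤ) (+ c - 1ℤ) + minor m (column c) (+ c - 1ℤ))
  ≡⟨ cong₂ (λ x y → (x + narayana (suc r) (suc m) c) + y) lower-rank (shifted-terms c) ⟩
    (narayana r (suc m) c + narayana (suc r) (suc m) c)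
      + shift (λ c′ → narayana (suc r) (suc m) c′ + narayana (suc (suc r)) (suc m) c′) c
  ∎
  where
  column : ℕ → ℤ
  column c′ = + (c′ ℕ.+ suc r)
  lower-rank : minor m (column c - 1ℤ) (+ c) ≡ narayana r (suc m) c
  lower-rank = cong (λ x → minor m (+ x - 1ℤ) (+ c)) (ℕP.+-suc c r)
  shifted-terms : ∀ c′ →
    minor m (column c′ - 1ℤ) (+ c′ - 1ℤ) + minor m (column c′) (+ c′ - 1ℤ)
    ≡ shift (λ c″ → narayana (suc r) (suc m) c″ + narayana (suc (suc r)) (suc m) c″) c′
  shifted-terms zero     = cong₂ _+_ (minor-below m (column 0 - 1ℤ) 0) (minor-below m (column 0) 0)
  shifted-terms (suc c′) =
    cong (λ x → minor m (column c′) (+ c′) + minor m (+ x) (+ c′)) (sym (ℕP.+-suc c′ (suc r)))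

sumℤ : ℕ → (ℕ → ℤ) → ℤ
sumℤ n f = sum (λ (i : Fin n) → f (toℕ i))

sumℤ-cong : ∀ n {f g : ℕ → ℤ} → (∀ x → f x ≡ g x) → sumℤ n f ≡ sumℤ n g
sumℤ-cong n e = sum-cong-≗ {n} (λ i → e (toℕ i))

sumℤ-zero : ∀ n → sumℤ n (λ _ → 0ℤ) ≡ 0ℤ
sumℤ-zero n = sum-replicate-zero n

sumℤ-+ : ∀ n (f g : ℕ → ℤ) → sumℤ n (λ x → f x + g x) ≡ sumℤ n f + sumℤ n g
sumℤ-+ n f g = ∑-distrib-+ {n} (λ i → f (toℕ i)) (λ i → g (toℕ i))

sumℤ-comm : ∀ m n (f : ℕ → ℕ → ℤ) →
            sumℤ m (λ x → sumℤ n (f x)) ≡ sumℤ n (λ y → sumℤ m (λ x → f x y))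
sumℤ-comm m n f = ∑-comm {m} {n} (λ i j → f (toℕ i) (toℕ j))

sumℤ-last : ∀ n (f : ℕ → ℤ) → sumℤ (suc n) f ≡ sumℤ n f + f n
sumℤ-last n f = trans (sum-init-last {n} (λ i → f (toℕ i)))
  (cong₂ _+_ (sum-cong-≗ {n} (λ i → cong f (toℕ-inject₁ i))) (cong f (toℕ-fromℕ n)))

conv : (ℕ → ℤ) → (ℕ → ℤ) → ℕ → ℤ
conv f g c = sumℤ (suc c) (λ k → f k * g (c ∸ k))

conv-congˡ : ∀ {f f′ : ℕ → ℤ} g → (∀ k → f k ≡ f′ k) → ∀ c → conv f g c ≡ conv f′ g c
conv-congˡ g e c = sumℤ-cong (suc c) (λ k → cong (_* g (c ∸ k)) (e k))

conv-+ˡ : ∀ (f h g : ℕ → ℤ) c → conv (λ k → f k + h k) g c ≡ conv f g c + conv h g c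
conv-+ˡ f h g c =
  trans (sumℤ-cong (suc c) (λ k → ℤP.*-distribʳ-+ (g (c ∸ k)) (f k) (h k)))
        (sumℤ-+ (suc c) (λ k → f k * g (c ∸ k)) (λ k → h k * g (c ∸ k)))

conv-zeroˡ : ∀ {f : ℕ → ℤ} g → (∀ k → f k ≡ 0ℤ) → ∀ c → conv f g c ≡ 0ℤ
conv-zeroˡ g e c = trans (sumℤ-cong (suc c) (λ k → cong (_* g (c ∸ k)) (e k))) (sumℤ-zero (suc c))

conv-zeroʳ : ∀ f {g : ℕ → ℤ} → (∀ k → g k ≡ 0ℤ) → ∀ c → conv f g c ≡ 0ℤ
conv-zeroʳ f e c =
  trans (sumℤ-cong (suc c) (λ k → trans (cong (f k *_) (e (c ∸ k))) (ℤP.*-zeroʳ (f k))))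
        (sumℤ-zero (suc c))

conv-unitˡ : ∀ g c → conv (narayana 0 0) g c ≡ g c
conv-unitˡ g c = begin
    1ℤ * g c + sumℤ c (λ _ → 0ℤ)
  ≡⟨ cong₂ _+_ (ℤP.*-identityˡ (g c)) (sumℤ-zero c) ⟩
    g c + 0ℤ
  ≡⟨ ℤP.+-identityʳ (g c) ⟩
    g c
  ∎

conv-shiftˡ : ∀ (f g : ℕ → ℤ) c → conv (shift f) g c ≡ shift (conv f g) c
conv-shiftˡ f g zero    = refl
conv-shiftˡ f g (suc c) = ℤP.+-identityˡ (conv f g c)

conv2 : (ℕ → ℕ → ℤ) → (ℕ → ℕ → ℤ) → ℕ → ℕ → ℤ
conv2 F G n c = sumℤ (suc n) (λ j → conv (F j) (G (n ∸ j)) c)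

conv2-congˡ : ∀ {F F′ : ℕ → ℕ → ℤ} G → (∀ j k → F j k ≡ F′ j k) → ∀ n c →
              conv2 F G n c ≡ conv2 F′ G n c
conv2-congˡ G e n c = sumℤ-cong (suc n) (λ j → conv-congˡ (G (n ∸ j)) (e j) c)

conv2-+ˡ : ∀ (F H G : ℕ → ℕ → ℤ) n c →
           conv2 (λ j k → F j k + H j k) G n c ≡ conv2 F G n c + conv2 H G n c
conv2-+ˡ F H G n c =
  trans (sumℤ-cong (suc n) (λ j → conv-+ˡ (F j) (H j) (G (n ∸ j)) c))
        (sumℤ-+ (suc n) (λ j → conv (F j) (G (n ∸ j)) c) (λ j → conv (H j) (G (n ∸ j)) c))

conv2-zeroˡ : ∀ {F : ℕ → ℕ → ℤ} G → (∀ j k → F j k ≡ 0ℤ) → ∀ n c → conv2 F G n c ≡ 0ℤ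
conv2-zeroˡ G e n c =
  trans (sumℤ-cong (suc n) (λ j → conv-zeroˡ (G (n ∸ j)) (e j) c)) (sumℤ-zero (suc n))

conv2-shiftˡ : ∀ (F G : ℕ → ℕ → ℤ) n c →
               conv2 (λ j → shift (F j)) G n c ≡ shift (λ c′ → conv2 F G n c′) c
conv2-shiftˡ F G n zero    =
  trans (sumℤ-cong (suc n) (λ j → conv-shiftˡ (F j) (G (n ∸ j)) 0)) (sumℤ-zero (suc n))
conv2-shiftˡ F G n (suc c) = sumℤ-cong (suc n) (λ j → conv-shiftˡ (F j) (G (n ∸ j)) (suc c))

conv2-interior : ∀ {F G : ℕ → ℕ → ℤ} → (∀ k → F 0 k ≡ 0ℤ) → (∀ k → G 0 k ≡ 0ℤ) → ∀ n c →
                 conv2 F G (suc n) c ≡ sumℤ n (λ j → conv (F (suc j)) (G (n ∸ j)) c)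
conv2-interior {F} {G} F₀ G₀ n c = begin
    conv (F 0) (G (suc n)) c + sumℤ (suc n) (λ j → conv (F (suc j)) (G (n ∸ j)) c)
  ≡⟨ cong₂ _+_ (conv-zeroˡ (G (suc n)) F₀ c) (sumℤ-last n (λ j → conv (F (suc j)) (G (n ∸ j)) c)) ⟩
    0ℤ + (interior + conv (F (suc n)) (G (n ∸ n)) c)
  ≡⟨ cong (λ x → 0ℤ + (interior + x)) (conv-zeroʳ (F (suc n)) G-last c) ⟩
    0ℤ + (interior + 0ℤ)
  ≡⟨ trans (ℤP.+-identityˡ _) (ℤP.+-identityʳ interior) ⟩
    interior
  ∎
  where
  interior : ℤ
  interior = sumℤ n (λ j → conv (F (suc j)) (G (n ∸ j)) c)
  G-last : ∀ k → G (n ∸ n) k ≡ 0ℤ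
  G-last k = trans (cong (λ m → G m k) (ℕP.n∸n≡0 n)) (G₀ k)

-- The convolution law  N_r ⋆ N_s = N_(r+s),  by induction on the row n
-- (for all ranks at once), using the recurrence  narayana-rec.
convolution : ∀ r s n c → conv2 (narayana r) (narayana s) n c ≡ narayana (r ℕ.+ s) n c
convolution zero    s zero    c = trans (ℤP.+-identityʳ _) (conv-unitˡ (narayana s 0) c)
convolution (suc r) s zero    c = cong (_+ 0ℤ) (conv-zeroˡ (narayana s 0) (λ _ → refl) c)
convolution zero    s (suc n) c = begin
    conv (narayana 0 0) (narayana s (suc n)) c + conv2 (λ j → narayana 0 (suc j)) (narayana s) n c
  ≡⟨ cong₂ _+_ (conv-unitˡ (narayana s (suc n)) c) (conv2-zeroˡ (narayana s) narayana-rank-zero n c) ⟩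
    narayana s (suc n) c + 0ℤ
  ≡⟨ ℤP.+-identityʳ _ ⟩
    narayana s (suc n) c
  ∎
convolution (suc r) s (suc n) c = begin
    conv (N (suc r) 0) (N s (suc n)) c + conv2 (λ j → N (suc r) (suc j)) (N s) n c
  ≡⟨ cong₂ _+_ (conv-zeroˡ (N s (suc n)) (λ _ → refl) c) (conv2-congˡ (N s) (narayana-rec r) n c) ⟩
    0ℤ + conv2 (λ j k → (N r j k + N (suc r) j k) + shift (upper j) k) (N s) n c
  ≡⟨ ℤP.+-identityˡ _ ⟩
    conv2 (λ j k → (N r j k + N (suc r) j k) + shift (upper j) k) (N s) n c
  ≡⟨ conv2-+ˡ (λ j k → N r j k + N (suc r) j k) (λ j → shift (upper j)) (N s) n c ⟩
    conv2 (λ j k → N r j k + N (suc r) j k) (N s) n c + conv2 (λ j → shift (upper j)) (N s) n c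
  ≡⟨ cong₂ _+_ (conv2-+ˡ (N r) (N (suc r)) (N s) n c) (conv2-shiftˡ upper (N s) n c) ⟩
    (conv2 (N r) (N s) n c + conv2 (N (suc r)) (N s) n c) + shift (λ c′ → conv2 upper (N s) n c′) c
  ≡⟨ cong₂ _+_ (cong₂ _+_ (convolution r s n c) (convolution (suc r) s n c))
               (shift-cong upper-convolution c) ⟩
    (N (r ℕ.+ s) n c + N (suc r ℕ.+ s) n c)
      + shift (λ c′ → N (suc r ℕ.+ s) n c′ + N (suc (suc r) ℕ.+ s) n c′) c
  ≡⟨ sym (narayana-rec (r ℕ.+ s) n c) ⟩
    N (suc r ℕ.+ s) (suc n) c
  ∎
  where
  N : ℕ → ℕ → ℕ → ℤ
  N = narayana
  upper : ℕ → ℕ → ℤ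
  upper j k = N (suc r) j k + N (suc (suc r)) j k
  upper-convolution : ∀ c′ → conv2 upper (N s) n c′ ≡ N (suc r ℕ.+ s) n c′ + N (suc (suc r) ℕ.+ s) n c′
  upper-convolution c′ = trans (conv2-+ˡ (N (suc r)) (N (suc (suc r))) (N s) n c′)
    (cong₂ _+_ (convolution (suc r) s n c′) (convolution (suc (suc r)) s n c′))

narayana₁-closed : ∀ j k → + suc k * narayana 1 (suc j) k ≡ + ((suc j C k) ℕ.* (j C k))
narayana₁-closed j k = begin
    + suc k * narayana 1 (suc j) k
  ≡⟨ cong (λ x → + suc k * minor j (+ x) (+ k)) (ℕP.+-comm k 1) ⟩
    + suc k * ((α + β) * α - β * γ)
  ≡⟨ combine₂ (- γ) α (step (+ k) (+ j) α β γ) (absorb₂ j k) (absorb₂ (suc j) k) ⟩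
    γ * α
  ≡⟨ binom-product (suc j) k j k ⟩
    + ((suc j C k) ℕ.* (j C k))
  ∎
  where
  α β γ : ℤ
  α = binom j k
  β = binom j (suc k)
  γ = binom (suc j) k
  step : ∀ K J α β γ →
    (1ℤ + K) * ((α + β) * α - β * γ) - γ * α
    ≡ (- γ) * (((1ℤ + K) * β + K * α) - J * α) + α * (((1ℤ + K) * (α + β) + K * γ) - (1ℤ + J) * γ)
  step = solve-∀

narayana₂-closed : ∀ M c →
  + suc (suc c) * narayana 2 (suc M) c ≡ + (2 ℕ.* ((suc M C c) ℕ.* (M C suc c)))
narayana₂-closed M c = begin
    + suc (suc c) * narayana 2 (suc M) c
  ≡⟨ cong (λ x → + suc (suc c) * minor M (+ x) (+ c)) (ℕP.+-comm c 2) ⟩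
    + suc (suc c) * ((q + s) * p - s * u)
  ≡⟨ combine₃ p (- u) q (step (+ c) (+ M) p q s u) (absorb₁ M (suc c)) (absorb₂ M (suc c)) (absorb₃ M c) ⟩
    + 2 * (u * q)
  ≡⟨ trans (cong (+ 2 *_) (binom-product (suc M) c M (suc c))) (sym (ℤP.pos-* 2 ((suc M C c) ℕ.* (M C suc c)))) ⟩
    + (2 ℕ.* ((suc M C c) ℕ.* (M C suc c)))
  ∎
  where
  p q s u : ℤ
  p = binom M c
  q = binom M (suc c)
  s = binom M (suc (suc c))
  u = binom (suc M) c
  step : ∀ C M p q s u →
    (1ℤ + (1ℤ + C)) * ((q + s) * p - s * u) - (1ℤ + 1ℤ) * (u * q)
    ≡ p * ((1ℤ + (1ℤ + C)) * (q + s) - (1ℤ + M) * q)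
      + (- u) * (((1ℤ + (1ℤ + C)) * s + (1ℤ + C) * q) - M * q)
      + q * (((1ℤ + M) * p + C * u) - (1ℤ + M) * u)
  step = solve-∀

ι : ℤ → ℚ
ι z = z / 1

ι-+ : ∀ a b → ι (a + b) ≡ ι a ℚ.+ ι b
ι-+ a b = ℚP.toℚᵘ-injective
  (ℚᵘP.≃-trans (as-fraction (a + b))
    (ℚᵘP.≃-trans (ℚᵘ.*≡* (cross-multiplied a b))
      (ℚᵘP.≃-sym (ℚᵘP.≃-trans (ℚP.toℚᵘ-homo-+ (ι a) (ι b))
                              (ℚᵘP.+-cong (as-fraction a) (as-fraction b))))))
  where
  as-fraction : ∀ z → ℚ.toℚᵘ (ι z) ℚᵘ.≃ ℚᵘ.mkℚᵘ z 0
  as-fraction z = ℚP.toℚᵘ-fromℚᵘ (ℚᵘ.mkℚᵘ z 0)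
  cross-multiplied : ∀ x y → (x + y) * 1ℤ ≡ (x * 1ℤ + y * 1ℤ) * (1ℤ * 1ℤ)
  cross-multiplied = solve-∀

frac-integral : ∀ p q z → + p ≡ + suc q * z → frac p (suc q) ≡ ι z
frac-integral p q z e = ℚP.fromℚᵘ-cong {ℚᵘ.mkℚᵘ (+ p) q} {ℚᵘ.mkℚᵘ z 0}
  (ℚᵘ.*≡* (trans (ℤP.*-identityʳ (+ p)) (trans e (ℤP.*-comm (+ suc q) z))))

sumFrom-shift : ∀ lo k f → sumFrom (suc lo) k f ≡ sumFrom lo k (λ x → f (suc x))
sumFrom-shift lo zero    f = refl
sumFrom-shift lo (suc k) f = cong (f (suc lo) ℚ.+_) (sumFrom-shift (suc lo) k f)

sumFrom-integral : ∀ k (f : ℕ → ℚ) (g : ℕ → ℤ) → (∀ x → x < k → f (suc x) ≡ ι (g x)) →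
                   sumFrom 1 k f ≡ ι (sumℤ k g)
sumFrom-integral zero    f g e = refl
sumFrom-integral (suc k) f g e = begin
    f 1 ℚ.+ sumFrom 2 k f
  ≡⟨ cong₂ ℚ._+_ (e 0 (s≤s ℕ.z≤n)) (trans (sumFrom-shift 1 k f)
       (sumFrom-integral k (λ x → f (suc x)) (λ x → g (suc x)) (λ x x<k → e (suc x) (s≤s x<k)))) ⟩
    ι (g 0) ℚ.+ ι (sumℤ k (λ x → g (suc x)))
  ≡⟨ sym (ι-+ (g 0) _) ⟩
    ι (sumℤ (suc k) g)
  ∎

narayana-product : ∀ i j e m →
  frac ((suc j C i) ℕ.* (j C i) ℕ.* (suc m C e) ℕ.* (m C e)) (suc i ℕ.* suc e)
  ≡ ι (narayana 1 (suc j) i * narayana 1 (suc m) e)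
narayana-product i j e m = frac-integral _ (e ℕ.+ i ℕ.* suc e) (X * Y) (begin
    + (a₁ ℕ.* a₂ ℕ.* a₃ ℕ.* a₄)
  ≡⟨ cong +_ (ℕP.*-assoc (a₁ ℕ.* a₂) a₃ a₄) ⟩
    + ((a₁ ℕ.* a₂) ℕ.* (a₃ ℕ.* a₄))
  ≡⟨ ℤP.pos-* (a₁ ℕ.* a₂) (a₃ ℕ.* a₄) ⟩
    + (a₁ ℕ.* a₂) * + (a₃ ℕ.* a₄)
  ≡⟨ sym (cong₂ _*_ (narayana₁-closed j i) (narayana₁-closed m e)) ⟩
    (+ suc i * X) * (+ suc e * Y)
  ≡⟨ regroup (+ suc i) X (+ suc e) Y ⟩
    (+ suc i * + suc e) * (X * Y)
  ≡⟨ cong (_* (X * Y)) (sym (ℤP.pos-* (suc i) (suc e))) ⟩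
    + (suc i ℕ.* suc e) * (X * Y)
  ∎)
  where
  a₁ a₂ a₃ a₄ : ℕ
  a₁ = suc j C i
  a₂ = j C i
  a₃ = suc m C e
  a₄ = m C e
  X Y : ℤ
  X = narayana 1 (suc j) i
  Y = narayana 1 (suc m) e
  regroup : ∀ a x b y → (a * x) * (b * y) ≡ (a * b) * (x * y)
  regroup = solve-∀

module _ (c M : ℕ) where

  -- The summand at  i = k+1,  j = m+1  as an integer:  N₁(m+1, k) · N₁(M−m, c−k).
  term : ℕ → ℕ → ℤ
  term k m = narayana 1 (suc m) k * narayana 1 (M ∸ m) (c ∸ k)

  summand-as-term : ∀ k m → k < suc c → m < M →
    summand (suc (suc c)) (suc (suc M)) (suc k) (suc m) ≡ ι (term k m)
  summand-as-term k m k≤c m<M =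
    shape (suc c ∸ k) (M ∸ m) (ℕP.+-∸-assoc 1 (ℕP.≤-pred k≤c)) (ℕP.+-∸-assoc 1 m<M)
    where
    shape : ∀ x y → x ≡ suc (c ∸ k) → y ≡ suc (M ∸ suc m) →
      frac ((suc m C k) ℕ.* (m C k) ℕ.* (y C (x ∸ 1)) ℕ.* ((M ∸ suc m) C (x ∸ 1))) (suc k ℕ.* x)
      ≡ ι (narayana 1 (suc m) k * narayana 1 y (c ∸ k))
    shape _ _ refl refl = narayana-product k m (c ∸ k) (M ∸ suc m)

  lhs-as-sum : LHS (suc (suc c)) (suc (suc M)) ≡ ι (sumℤ (suc c) (λ k → sumℤ M (term k)))
  lhs-as-sum =
    sumFrom-integral (suc c) (λ i → sumFrom 1 M (summand b n i)) (λ k → sumℤ M (term k))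
      (λ k k≤c → sumFrom-integral M (summand b n (suc k)) (term k)
        (λ m m<M → summand-as-term k m k≤c m<M))
    where
    b n : ℕ
    b = suc (suc c)
    n = suc (suc M)

  rhs-as-narayana : RHS (suc (suc c)) (suc (suc M)) ≡ ι (narayana 2 (suc M) c)
  rhs-as-narayana = frac-integral _ (suc c) _ (sym (narayana₂-closed M c))

corollary4p3 : (b n : ℕ) → b ≥ 2 → n ≥ 2 → LHS b n ≡ RHS b n
corollary4p3 (suc (suc c)) (suc (suc M)) _ _ = begin
    LHS (suc (suc c)) (suc (suc M))
  ≡⟨ lhs-as-sum c M ⟩
    ι (sumℤ (suc c) (λ k → sumℤ M (term c M k)))
  ≡⟨ cong ι (sumℤ-comm (suc c) M (term c M)) ⟩
    ι (sumℤ M (λ m → conv (narayana 1 (suc m)) (narayana 1 (M ∸ m)) c))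
  ≡⟨ cong ι (sym (conv2-interior {narayana 1} {narayana 1} (λ _ → refl) (λ _ → refl) M c)) ⟩
    ι (conv2 (narayana 1) (narayana 1) (suc M) c)
  ≡⟨ cong ι (convolution 1 1 (suc M) c) ⟩
    ι (narayana 2 (suc M) c)
  ≡⟨ sym (rhs-as-narayana c M) ⟩
    RHS (suc (suc c)) (suc (suc M))
  ∎
corollary4p3 0             _             ()          _
corollary4p3 1             _             (s≤s ())    _
corollary4p3 (suc (suc c)) 0             _           ()
corollary4p3 (suc (suc c)) 1             _           (s≤s ())
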